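{- Let $\Phi$ be a satisfiable formula of $\mathbb{BST}^{+}$, and let $\mathrm{Vars}(\Phi)$ be the set of variables occurring in $\Phi$. Then for every $\flat \geq |\mathrm{Vars}(\Phi)|+1$, $\Phi$ admits a $\flat$-flat set model, i.e. a $\flat$-flat set assignment over $\mathrm{Vars}(\Phi)$ satisfying $\Phi$.
   Context: $\mathbb{BST}^{+}$ is the collection of all propositional combinations (using $\wedge,\vee,\to,\leftrightarrow,\neg$) of atoms of the form $x = y\setminus z$, where $x,y,z$ are set variables ranging over the von Neumann universe $\mathcal{V}$ of well-founded sets. A set assignment over a finite set $V$ of variables is a map $M:V\to\mathcal{V}$; it satisfies $x=y\setminus z$ iff $Mx = My\setminus Mz$ (ordinary set difference), and satisfaction extends to propositional combinations in the usual way; a formula is satisfiable if some set assignment over (a superset of) its variables satisfies it. The rank $\operatorname{rk}s$ of $s\in\mathcal{V}$ is the ordinal $\alpha$ with $s\in\mathcal{V}_{\alpha+1}\setminus\mathcal{V}_\alpha$, where $\mathcal{V}_\alpha=\bigcup_{\beta<\alpha}\mathcal{P}(\mathcal{V}_\beta)$. For an ordinal $\flat\ge 1$, an assignment $M$ over $V$ is $\flat$-flat if every element of $\bigcup\{Mv\mid v\in V\}$ has rank $\flat$. -}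

module Defs where

open import Data.Nat using (ℕ; zero; suc; _≟_)
open import Data.List using (List; []; _∷_; _++_; length; deduplicate)
open import Data.List.Membership.Propositional using () renaming (_∈_ to _∈ₗ_)
open import Data.Product using (Σ; _×_; _,_; proj₁)
open import Data.Sum using (_⊎_; inj₁; inj₂; [_,_])
open import Data.Empty using (⊥; ⊥-elim)
open import Data.Unit using (⊤; tt)
open import Relation.Nullary using (¬_)

-- Well-founded sets: Aczel's iterative sets (the cumulative hierarchy
-- inside type theory).  Extensional equality is bisimulation.

data 𝕍 : Set₁ where
  sup : (A : Set) → (A → 𝕍) → 𝕍

_≅_ : 𝕍 → 𝕍 → Set
sup A f ≅ sup B g =
  ((a : A) → Σ B λ b → f a ≅ g b) × ((b : B) → Σ A λ a → f a ≅ g b)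

_∈_ : 𝕍 → 𝕍 → Set
x ∈ sup A f = Σ A λ a → x ≅ f a

_⊆_ : 𝕍 → 𝕍 → Set₁
x ⊆ y = (z : 𝕍) → z ∈ x → z ∈ y

_∖_ : 𝕍 → 𝕍 → 𝕍
sup A f ∖ z = sup (Σ A λ a → ¬ (f a ∈ z)) (λ p → f (proj₁ p))

Transitive : 𝕍 → Set₁
Transitive x = (y : 𝕍) → y ∈ x → (z : 𝕍) → z ∈ y → z ∈ x

-- with foundation (automatic for 𝕍), a von Neumann ordinal is a
-- transitive set of transitive sets
IsOrdinal : 𝕍 → Set₁
IsOrdinal α = Transitive α × ((β : 𝕍) → β ∈ α → Transitive β)

succ : 𝕍 → 𝕍
succ (sup A f) = sup (A ⊎ ⊤) [ f , (λ _ → sup A f) ]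

ord : ℕ → 𝕍
ord zero = sup ⊥ ⊥-elim
ord (suc n) = succ (ord n)

-- s ∈ 𝒱_α, where 𝒱_α = ⋃_{β ∈ α} 𝒫(𝒱_β)
-- i.e. there is β ∈ α with every element of s in 𝒱_β
InV : 𝕍 → 𝕍 → Set
InV (sup A f) (sup B g) = Σ A λ a → (b : B) → InV (f a) (g b)

-- rk s = α  iff  s ∈ 𝒱_{α+1} ∖ 𝒱_α
HasRank : 𝕍 → 𝕍 → Set
HasRank s α = InV (succ α) s × ¬ InV α s

data Formula : Set where
  diff : (x y z : ℕ) → Formula
  _∧'_ _∨'_ _⇒'_ _⇔'_ : Formula → Formula → Formula
  ¬'_ : Formula → Formula

vars : Formula → List ℕ
vars (diff x y z) = x ∷ y ∷ z ∷ []
vars (φ ∧' ψ) = vars φ ++ vars ψ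
vars (φ ∨' ψ) = vars φ ++ vars ψ
vars (φ ⇒' ψ) = vars φ ++ vars ψ
vars (φ ⇔' ψ) = vars φ ++ vars ψ
vars (¬' φ) = vars φ

numVars : Formula → ℕ
numVars φ = length (deduplicate _≟_ (vars φ))

Assignment : Set₁
Assignment = ℕ → 𝕍

_⊨_ : Assignment → Formula → Set
M ⊨ diff x y z = M x ≅ (M y ∖ M z)
M ⊨ (φ ∧' ψ) = (M ⊨ φ) × (M ⊨ ψ)
M ⊨ (φ ∨' ψ) = (M ⊨ φ) ⊎ (M ⊨ ψ)
M ⊨ (φ ⇒' ψ) = (M ⊨ φ) → (M ⊨ ψ)
M ⊨ (φ ⇔' ψ) = ((M ⊨ φ) → (M ⊨ ψ)) × ((M ⊨ ψ) → (M ⊨ φ))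
M ⊨ (¬' φ) = ¬ (M ⊨ φ)

Satisfiable : Formula → Set₁
Satisfiable φ = Σ Assignment λ M → M ⊨ φ

Flat : 𝕍 → Assignment → Formula → Set₁
Flat ♭ M φ = (v : ℕ) → v ∈ₗ vars φ → (t : 𝕍) → t ∈ M v → HasRank t ♭

-- classical metatheory (the paper works in ZF)
LEM : Set₁
LEM = (P : Set) → P ⊎ ¬ P

-- Let n = |Vars Φ| and let M satisfy Φ. Whether Φ holds depends only on
-- which of the n "Venn regions" of the sets M v each element lies in.
-- Encode the region of an element u by its signature: ♭ with the ordinals
-- k < n removed for which u ∉ M v_k. Signatures of elements in different
-- regions differ, so replacing every element by its signature preserves
-- all atoms x = y ∖ z. Each signature contains the ordinal n ∈ ♭ and is
-- contained in ♭, which forces its rank to be exactly ♭.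
module Submission where

open import Defs
open import Data.Nat using (ℕ; suc; _<_; _≤_; _≟_; s≤s)
open import Data.Nat.Properties using (<-cmp; <-irrefl; <⇒≤; ≤-refl; m≤n⇒m<n∨m≡n)
open import Data.Product using (Σ; _×_; _,_; proj₁; proj₂)
open import Data.Product.Function.NonDependent.Propositional using (_×-⇔_)
open import Data.Sum using (inj₁; inj₂)
open import Data.Sum.Function.Propositional using (_⊎-⇔_)
open import Data.Empty using (⊥-elim)
open import Data.Unit using (tt)
open import Data.Fin using (Fin; toℕ)
open import Data.Fin.Properties using (toℕ-injective; toℕ<n)
open import Data.List using (List; length; lookup; deduplicate)
open import Data.List.Membership.Propositional using () renaming (_∈_ to _∈ₗ_)
open import Data.List.Membership.Propositional.Properties using (∈-deduplicate⁺; ∈-++⁺ˡ; ∈-++⁺ʳ)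
open import Data.List.Relation.Binary.Subset.Propositional using () renaming (_⊆_ to _⊆ₗ_)
open import Data.List.Relation.Unary.Any using (index; here; there)
open import Data.List.Relation.Unary.Any.Properties using (lookup-index)
open import Function using (_∘_)
open import Function.Bundles using (_⇔_; mk⇔; Equivalence)
open import Function.Properties.Equivalence using () renaming (sym to ⇔-sym; trans to ⇔-trans)
open import Function.Related.TypeIsomorphisms using (→-cong-⇔; ¬-cong-⇔)
open import Relation.Nullary using (¬_)
open import Relation.Binary using (tri<; tri≈; tri>)
open import Relation.Binary.PropositionalEquality using (_≡_; refl; sym; subst)

open Equivalence using (to; from)

≅-refl : (x : 𝕍) → x ≅ x
≅-refl (sup A f) = (λ a → a , ≅-refl (f a)) , (λ a → a , ≅-refl (f a))

≅-sym : (x y : 𝕍) → x ≅ y → y ≅ x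
≅-sym (sup A f) (sup B g) (f⊆g , g⊆f) =
  (λ b → proj₁ (g⊆f b) , ≅-sym (f (proj₁ (g⊆f b))) (g b) (proj₂ (g⊆f b))) ,
  (λ a → proj₁ (f⊆g a) , ≅-sym (f a) (g (proj₁ (f⊆g a))) (proj₂ (f⊆g a)))

≅-trans : (x y z : 𝕍) → x ≅ y → y ≅ z → x ≅ z
≅-trans (sup A f) (sup B g) (sup C h) (f⊆g , g⊆f) (g⊆h , h⊆g) =
  (λ a → let b = proj₁ (f⊆g a) ; c = proj₁ (g⊆h b) in
    c , ≅-trans (f a) (g b) (h c) (proj₂ (f⊆g a)) (proj₂ (g⊆h b))) ,
  (λ c → let b = proj₁ (h⊆g c) ; a = proj₁ (g⊆f b) in
    a , ≅-trans (f a) (g b) (h c) (proj₂ (g⊆f b)) (proj₂ (h⊆g c)))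

∈-respˡ : (x x′ s : 𝕍) → x ≅ x′ → x ∈ s → x′ ∈ s
∈-respˡ x x′ (sup A f) x≅x′ (a , x≅fa) = a , ≅-trans x′ x (f a) (≅-sym x x′ x≅x′) x≅fa

∈-respʳ : (x s s′ : 𝕍) → s ≅ s′ → x ∈ s → x ∈ s′
∈-respʳ x (sup A f) (sup B g) (f⊆g , _) (a , x≅fa) =
  proj₁ (f⊆g a) , ≅-trans x (f a) (g (proj₁ (f⊆g a))) x≅fa (proj₂ (f⊆g a))

≅⇔same-elements : (a b : 𝕍) → (a ≅ b) ⇔ ((w : 𝕍) → (w ∈ a) ⇔ (w ∈ b))
≅⇔same-elements (sup A f) (sup B g) = mk⇔ same ext
  where
  same : sup A f ≅ sup B g → (w : 𝕍) → (w ∈ sup A f) ⇔ (w ∈ sup B g)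
  same e w = mk⇔ (∈-respʳ w (sup A f) (sup B g) e)
                 (∈-respʳ w (sup B g) (sup A f) (≅-sym (sup A f) (sup B g) e))

  ext : ((w : 𝕍) → (w ∈ sup A f) ⇔ (w ∈ sup B g)) → sup A f ≅ sup B g
  ext h =
    (λ a → to (h (f a)) (a , ≅-refl (f a))) ,
    (λ b → let (a , gb≅fa) = from (h (g b)) (b , ≅-refl (g b)) in
      a , ≅-sym (g b) (f a) gb≅fa)

∈-∖ : (w a c : 𝕍) → (w ∈ (a ∖ c)) ⇔ ((w ∈ a) × ¬ (w ∈ c))
∈-∖ w (sup A f) c = mk⇔
  (λ ((a , fa∉c) , w≅fa) → (a , w≅fa) , fa∉c ∘ ∈-respˡ w (f a) c w≅fa)
  (λ ((a , w≅fa) , w∉c) → (a , w∉c ∘ ∈-respˡ (f a) w c (≅-sym w (f a) w≅fa)) , w≅fa)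

InV-resp : (x x′ y y′ : 𝕍) → x ≅ x′ → y ≅ y′ → InV x y → InV x′ y′
InV-resp (sup A f) (sup A′ f′) (sup B g) (sup B′ g′) (f⊆f′ , _) (_ , g′⊆g) (a , below) =
  proj₁ (f⊆f′ a) , λ b′ → InV-resp (f a) (f′ (proj₁ (f⊆f′ a))) (g (proj₁ (g′⊆g b′))) (g′ b′)
    (proj₂ (f⊆f′ a)) (proj₂ (g′⊆g b′)) (below (proj₁ (g′⊆g b′)))

∈⇒InV : (x y : 𝕍) → y ∈ x → InV x y
∈⇒InV (sup A f) (sup C h) (a , y≅fa) =
  a , λ c → ∈⇒InV (f a) (h c) (∈-respʳ (h c) (sup C h) (f a) y≅fa (c , ≅-refl (h c)))

InV-irrefl : (x : 𝕍) → ¬ InV x x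
InV-irrefl (sup A f) (a , below) = InV-irrefl (f a) (below a)

InV⇒∉ : (x y : 𝕍) → InV x y → ¬ (x ∈ y)
InV⇒∉ (sup A f) (sup C h) (a , below) (c , x≅hc) =
  InV⇒∉ (f a) (sup A f)
    (InV-resp (f a) (f a) (h c) (sup A f) (≅-refl (f a)) (≅-sym (sup A f) (h c) x≅hc) (below c))
    (a , ≅-refl (f a))

∈-irrefl : (x : 𝕍) → ¬ (x ∈ x)
∈-irrefl x = InV-irrefl x ∘ ∈⇒InV x x

⊆⇒InV-succ : (α s : 𝕍) → s ⊆ α → InV (succ α) s
⊆⇒InV-succ (sup B g) (sup C h) s⊆α =
  inj₂ tt , λ c → ∈⇒InV (sup B g) (h c) (s⊆α (h c) (c , ≅-refl (h c)))

HasRank-resp : (α t t′ : 𝕍) → t ≅ t′ → HasRank t α → HasRank t′ α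
HasRank-resp α t t′ t≅t′ (t∈V , t∉V) =
  InV-resp (succ α) (succ α) t t′ (≅-refl (succ α)) t≅t′ t∈V ,
  t∉V ∘ InV-resp α α t′ t (≅-refl α) (≅-sym t t′ t≅t′)

∈-succ-self : (x : 𝕍) → x ∈ succ x
∈-succ-self (sup A f) = inj₂ tt , ≅-refl (sup A f)

∈⇒∈-succ : (y x : 𝕍) → y ∈ x → y ∈ succ x
∈⇒∈-succ y (sup A f) (a , y≅fa) = inj₁ a , y≅fa

ord-<⇒∈ : {i j : ℕ} → i < j → ord i ∈ ord j
ord-<⇒∈ {i} {suc j} (s≤s i≤j) with m≤n⇒m<n∨m≡n i≤j
... | inj₁ i<j = ∈⇒∈-succ (ord i) (ord j) (ord-<⇒∈ i<j)
... | inj₂ refl = ∈-succ-self (ord i)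

ord-injective : (i j : ℕ) → ord i ≅ ord j → i ≡ j
ord-injective i j i≅j with <-cmp i j
... | tri< i<j _ _ = ⊥-elim (∈-irrefl (ord i)
        (∈-respʳ (ord i) (ord j) (ord i) (≅-sym (ord i) (ord j) i≅j) (ord-<⇒∈ i<j)))
... | tri≈ _ i≡j _ = i≡j
... | tri> _ _ j<i = ⊥-elim (∈-irrefl (ord j) (∈-respʳ (ord j) (ord i) (ord j) i≅j (ord-<⇒∈ j<i)))

image : (𝕍 → 𝕍) → 𝕍 → 𝕍
image T (sup A f) = sup A (T ∘ f)

∈-image : (T : 𝕍 → 𝕍) (s w : 𝕍) → w ∈ image T s → Σ 𝕍 λ u → (u ∈ s) × (w ≅ T u)
∈-image T (sup A f) w (a , w≅Tfa) = f a , (a , ≅-refl (f a)) , w≅Tfa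

-- Replacing each element u of every M v by T u preserves all formulas over
-- D, provided T respects ≅ and identifies only elements lying in the same
-- Venn region of the sets M v, v ∈ D.
module Image (M : Assignment) (D : List ℕ) (T : 𝕍 → 𝕍)
             (T-cong : (u u′ : 𝕍) → u ≅ u′ → T u ≅ T u′)
             (T-reflects : (v : ℕ) → v ∈ₗ D → (u u′ : 𝕍) → T u ≅ T u′ → u′ ∈ M v → u ∈ M v)
             where

  M′ : Assignment
  M′ = image T ∘ M

  T∈M′⇔∈M : (v : ℕ) → v ∈ₗ D → (u : 𝕍) → (T u ∈ M′ v) ⇔ (u ∈ M v)
  T∈M′⇔∈M v v∈D u = mk⇔ reflect (preserve (M v))
    where
    reflect : T u ∈ M′ v → u ∈ M v
    reflect Tu∈ = let (u′ , u′∈ , Tu≅Tu′) = ∈-image T (M v) (T u) Tu∈ in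
      T-reflects v v∈D u u′ Tu≅Tu′ u′∈

    preserve : (s : 𝕍) → u ∈ s → T u ∈ image T s
    preserve (sup A f) (a , u≅fa) = a , T-cong u (f a) u≅fa

  InRange : 𝕍 → Set₁
  InRange a = (w : 𝕍) → w ∈ a → Σ 𝕍 λ u → w ≅ T u

  M′-InRange : (v : ℕ) → InRange (M′ v)
  M′-InRange v w w∈ = let (u , _ , w≅Tu) = ∈-image T (M v) w w∈ in u , w≅Tu

  ∖-InRange : (a c : 𝕍) → InRange a → InRange (a ∖ c)
  ∖-InRange a c a-in w = a-in w ∘ proj₁ ∘ to (∈-∖ w a c)

  ≅-from-range : (a b : 𝕍) → InRange a → InRange b →
                 ((u : 𝕍) → (T u ∈ a) ⇔ (T u ∈ b)) → a ≅ b
  ≅-from-range a b a-in b-in same = from (≅⇔same-elements a b) λ w → mk⇔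
    (move a b a-in (to ∘ same) w) (move b a b-in (from ∘ same) w)
    where
    move : (x y : 𝕍) → InRange x → ((u : 𝕍) → T u ∈ x → T u ∈ y) → (w : 𝕍) → w ∈ x → w ∈ y
    move x y x-in x⇒y w w∈x =
      let (u , w≅Tu) = x-in w w∈x in
      ∈-respˡ (T u) w y (≅-sym w (T u) w≅Tu) (x⇒y u (∈-respˡ w (T u) x w≅Tu w∈x))

  sat-diff : (x y z : ℕ) → x ∈ₗ D → y ∈ₗ D → z ∈ₗ D →
             (M x ≅ (M y ∖ M z)) ⇔ (M′ x ≅ (M′ y ∖ M′ z))
  sat-diff x y z x∈D y∈D z∈D = mk⇔
    (λ e → ≅-from-range (M′ x) (M′ y ∖ M′ z) (M′-InRange x) (∖-InRange (M′ y) (M′ z) (M′-InRange y))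
       λ u → ⇔-trans (T∈M′⇔∈M x x∈D u)
               (⇔-trans (to (≅⇔same-elements (M x) (M y ∖ M z)) e u) (difference u)))
    (λ e → from (≅⇔same-elements (M x) (M y ∖ M z)) λ u →
       ⇔-trans (⇔-sym (T∈M′⇔∈M x x∈D u))
         (⇔-trans (to (≅⇔same-elements (M′ x) (M′ y ∖ M′ z)) e (T u)) (⇔-sym (difference u))))
    where
    difference : (u : 𝕍) → (u ∈ (M y ∖ M z)) ⇔ (T u ∈ (M′ y ∖ M′ z))
    difference u =
      ⇔-trans (∈-∖ u (M y) (M z))
        (⇔-trans (⇔-sym (T∈M′⇔∈M y y∈D u ×-⇔ ¬-cong-⇔ (T∈M′⇔∈M z z∈D u)))
          (⇔-sym (∈-∖ (T u) (M′ y) (M′ z))))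

  sat : (ψ : Formula) → vars ψ ⊆ₗ D → (M ⊨ ψ) ⇔ (M′ ⊨ ψ)
  sat (diff x y z) sub = sat-diff x y z (sub (here refl)) (sub (there (here refl)))
                                        (sub (there (there (here refl))))
  sat (φ ∧' ψ) sub = sat φ (sub ∘ ∈-++⁺ˡ) ×-⇔ sat ψ (sub ∘ ∈-++⁺ʳ (vars φ))
  sat (φ ∨' ψ) sub = sat φ (sub ∘ ∈-++⁺ˡ) ⊎-⇔ sat ψ (sub ∘ ∈-++⁺ʳ (vars φ))
  sat (φ ⇒' ψ) sub = →-cong-⇔ (sat φ (sub ∘ ∈-++⁺ˡ)) (sat ψ (sub ∘ ∈-++⁺ʳ (vars φ)))
  sat (φ ⇔' ψ) sub = →-cong-⇔ φ⇔ ψ⇔ ×-⇔ →-cong-⇔ ψ⇔ φ⇔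
    where
    φ⇔ = sat φ (sub ∘ ∈-++⁺ˡ)
    ψ⇔ = sat ψ (sub ∘ ∈-++⁺ʳ (vars φ))
  sat (¬' φ) sub = ¬-cong-⇔ (sat φ sub)

module Signature (lem : LEM) (M : Assignment) (D : List ℕ) (B : Set) (g : B → 𝕍)
                 (ords⊆♭ : ord (suc (length D)) ⊆ sup B g) where

  n : ℕ
  n = length D

  ♭ : 𝕍
  ♭ = sup B g

  Excluded : 𝕍 → 𝕍 → Set
  Excluded u β = Σ (Fin n) λ k → ¬ (u ∈ M (lookup D k)) × (β ≅ ord (toℕ k))

  signature : 𝕍 → 𝕍
  signature u = sup (Σ B λ b → ¬ Excluded u (g b)) (g ∘ proj₁)

  ord∈♭ : (i : ℕ) → i ≤ n → Σ B λ b → ord i ≅ g b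
  ord∈♭ i i≤n = ords⊆♭ (ord i) (ord-<⇒∈ (s≤s i≤n))

  ord-∈-signature⇔ : (u : 𝕍) (k : Fin n) → (ord (toℕ k) ∈ signature u) ⇔ (u ∈ M (lookup D k))
  ord-∈-signature⇔ u k = mk⇔ reflect include
    where
    reflect : ord (toℕ k) ∈ signature u → u ∈ M (lookup D k)
    reflect ((b , included) , k≅gb) with lem (u ∈ M (lookup D k))
    ... | inj₁ u∈ = u∈
    ... | inj₂ u∉ = ⊥-elim (included (k , u∉ , ≅-sym (ord (toℕ k)) (g b) k≅gb))

    include : u ∈ M (lookup D k) → ord (toℕ k) ∈ signature u
    include u∈ = let (b , k≅gb) = ord∈♭ (toℕ k) (<⇒≤ (toℕ<n k)) in
      (b , λ (k′ , u∉ , gb≅k′) →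
        let k≡k′ = toℕ-injective (ord-injective (toℕ k) (toℕ k′)
                     (≅-trans (ord (toℕ k)) (g b) (ord (toℕ k′)) k≅gb gb≅k′)) in
        u∉ (subst (λ j → u ∈ M (lookup D j)) k≡k′ u∈)) ,
      k≅gb

  signature-cong : (u u′ : 𝕍) → u ≅ u′ → signature u ≅ signature u′
  signature-cong u u′ u≅u′ =
    (λ (b , included) → (b , keep u u′ (λ s → ∈-respˡ u u′ s u≅u′) included) , ≅-refl (g b)) ,
    (λ (b , included) → (b , keep u′ u (λ s → ∈-respˡ u′ u s (≅-sym u u′ u≅u′)) included) ,
                        ≅-refl (g b))
    where
    keep : (x y : 𝕍) → ((s : 𝕍) → x ∈ s → y ∈ s) → {β : 𝕍} → ¬ Excluded x β → ¬ Excluded y β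
    keep x y x⇒y included (k , y∉ , e) = included (k , y∉ ∘ x⇒y _ , e)

  signature-reflects : (v : ℕ) → v ∈ₗ D → (u u′ : 𝕍) →
                       signature u ≅ signature u′ → u′ ∈ M v → u ∈ M v
  signature-reflects v v∈D u u′ e u′∈ =
    subst (λ w → u ∈ M w) (sym (lookup-index v∈D))
      (to (ord-∈-signature⇔ u k)
        (∈-respʳ (ord (toℕ k)) (signature u′) (signature u) (≅-sym (signature u) (signature u′) e)
          (from (ord-∈-signature⇔ u′ k) (subst (λ w → u′ ∈ M w) (lookup-index v∈D) u′∈))))
    where
    k = index v∈D

  -- The ordinal n is never excluded, so every signature contains an element
  -- of ♭ above all the excluded ones.
  signature∉V♭ : (u : 𝕍) → ¬ InV ♭ (signature u)
  signature∉V♭ u (b₀ , below) with lem (Excluded u (g b₀))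
  ... | inj₂ included = InV-irrefl (g b₀) (below (b₀ , included))
  ... | inj₁ (k , _ , gb₀≅k) =
    let (b , n≅gb) = ord∈♭ n ≤-refl
        n-included : ¬ Excluded u (g b)
        n-included (k′ , _ , gb≅k′) =
          <-irrefl (sym (ord-injective n (toℕ k′) (≅-trans (ord n) (g b) (ord (toℕ k′)) n≅gb gb≅k′)))
                   (toℕ<n k′)
    in InV⇒∉ (ord (toℕ k)) (ord n)
         (InV-resp (g b₀) (ord (toℕ k)) (g b) (ord n) gb₀≅k (≅-sym (ord n) (g b) n≅gb)
           (below (b , n-included)))
         (ord-<⇒∈ (toℕ<n k))

  signature-rank : (u : 𝕍) → HasRank (signature u) ♭
  signature-rank u =
    ⊆⇒InV-succ ♭ (signature u) (λ { w ((b , _) , w≅gb) → b , w≅gb }) , signature∉V♭ u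

  image-signature-rank : (s t : 𝕍) → t ∈ image signature s → HasRank t ♭
  image-signature-rank s t t∈ = let (u , _ , t≅σu) = ∈-image signature s t t∈ in
    HasRank-resp ♭ (signature u) t (≅-sym t (signature u) t≅σu) (signature-rank u)

lemma3 : LEM → (Φ : Formula) → Satisfiable Φ →
    (♭ : 𝕍) → IsOrdinal ♭ → ord (suc (numVars Φ)) ⊆ ♭ →
    Σ Assignment (λ M → Flat ♭ M Φ × (M ⊨ Φ))
lemma3 lem Φ (M , M⊨Φ) (sup B g) _ ords⊆♭ =
  image signature ∘ M ,
  (λ v _ → image-signature-rank (M v)) ,
  to (sat Φ (∈-deduplicate⁺ _≟_)) M⊨Φ
  where
  D = deduplicate _≟_ (vars Φ)
  open Signature lem M D B g ords⊆♭
  open Image M D signature signature-cong signature-reflects
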